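{- Let $m\ge1$ and let $b=b_0b_1\dots b_{m-1}$ be a string of length $m$ over $\{0,1\}$ containing no two consecutive $1$'s. Let $T_{00}=\{k: 0<k<m,\ b_{k-1}b_k=00\}$. Then $$1+\sum_{k\in T_{00}}F_k=\begin{cases}-\sum_{i=0}^{m-2}b_iF_{i+2}+F_{m+1} & \text{if } b_{m-1}=0,\\ -\sum_{i=0}^{m-1}b_iF_{i+2}+F_{m+2} & \text{if } b_{m-1}=1.\end{cases}$$
   Context: $F_i$ are the Fibonacci numbers: $F_0=0$, $F_1=1$, $F_{m+1}=F_m+F_{m-1}$. -}

module Defs where

open import Data.Nat using (ℕ; zero; suc; _<_; _<?_)
open import Data.Bool using (Bool; true; false; _∧_; not; if_then_else_)
open import Data.Fin using (Fin; fromℕ<)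
open import Data.Integer using (ℤ; +_; _+_)
open import Relation.Nullary using (yes; no)
open import Relation.Binary.PropositionalEquality using (_≡_)

fib : ℕ → ℕ
fib zero = 0
fib (suc zero) = 1
fib (suc (suc n)) = fib (suc n) Data.Nat.+ fib n

sumBelow : ℕ → (ℕ → ℤ) → ℤ
sumBelow zero f = + 0
sumBelow (suc n) f = sumBelow n f + f n

-- total bit accessor: b_i for i < m (value for i ≥ m is never used by the statement)
bit : {m : ℕ} → (Fin m → Bool) → ℕ → Bool
bit {m} b i with i <? m
... | yes i<m = b (fromℕ< i<m)
... | no _ = false

bitℤ : Bool → ℤ
bitℤ true = + 1
bitℤ false = + 0

NoConsecutiveOnes : {m : ℕ} → (Fin m → Bool) → Set
NoConsecutiveOnes {m} b = ∀ (i : ℕ) → suc i < m → bit b i ∧ bit b (suc i) ≡ false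

sumT00 : {m : ℕ} → (Fin m → Bool) → ℤ
sumT00 {m} b = sumBelow m (λ k → term k)
  where
  term : ℕ → ℤ
  term zero = + 0
  term (suc j) = if not (bit b j) ∧ not (bit b (suc j)) then + fib (suc j) else + 0

-- Scanning b from left to right, the quantity 1 + Σ_{k ∈ T₀₀, k ≤ j} F_k + Σ_{i ≤ j} b_i F_{i+2}
-- equals F_{j+2} when b_j = 0 and F_{j+3} when b_j = 1: appending a bit to a prefix ending in 0
-- either adds F_{j+1} (pattern 00) or F_{j+3} (pattern 01), and after a 1 the next bit is 0 and
-- nothing is added. Both cases of the theorem are this invariant at j = m − 1, with the weight
-- b_{m−1} F_{m+1} = 0 dropped from the sum in the first case.
module Submission where

open import Defs
open import Data.Nat using (ℕ; zero; suc; _+_; _<_; _<?_)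
import Data.Nat as ℕ
import Data.Nat.Properties as ℕ
open import Data.Bool using (Bool; true; false; _∧_; not; if_then_else_)
open import Data.Fin using (Fin; fromℕ)
open import Data.Fin.Properties using (fromℕ-def)
open import Data.Integer using (ℤ; +_; _-_; _*_)
import Data.Integer as ℤ
import Data.Integer.Properties as ℤ
open import Data.Integer.Tactic.RingSolver using (solve-∀)
open import Data.Product using (_×_; _,_)
open import Data.Empty using (⊥-elim)
open import Relation.Nullary using (yes; no)
open import Relation.Binary.PropositionalEquality
  using (_≡_; refl; sym; trans; cong; cong₂; module ≡-Reasoning)

sumBelow-cong : ∀ n {f g : ℕ → ℤ} → (∀ i → f i ≡ g i) → sumBelow n f ≡ sumBelow n g
sumBelow-cong zero    f≗g = refl
sumBelow-cong (suc n) f≗g = cong₂ ℤ._+_ (sumBelow-cong n f≗g) (f≗g n)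

x+y≡z⇒x≡z-y : ∀ {x y z : ℤ} → x ℤ.+ y ≡ z → x ≡ z - y
x+y≡z⇒x≡z-y {x} {y} refl = lemma x y
  where
  lemma : ∀ x y → x ≡ (x ℤ.+ y) - y
  lemma = solve-∀

t00 : (ℕ → Bool) → ℕ → ℤ
t00 c zero    = + 0
t00 c (suc j) = if not (c j) ∧ not (c (suc j)) then + fib (suc j) else + 0

weight : (ℕ → Bool) → ℕ → ℤ
weight c i = bitℤ (c i) * + fib (i + 2)

weight-false : ∀ c i → c i ≡ false → weight c i ≡ + 0
weight-false c i c≡false = cong (λ v → bitℤ v * + fib (i + 2)) c≡false

topFib : Bool → ℕ → ℤ
topFib false j = + fib (2 + j)
topFib true  j = + fib (3 + j)

topFib-step : ∀ a b j → a ∧ b ≡ false →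
  topFib a j ℤ.+ ((if not a ∧ not b then + fib (suc j) else + 0) ℤ.+ bitℤ b * + fib (3 + j))
    ≡ topFib b (suc j)
topFib-step false false j _ = cong (λ k → + (fib (2 + j) + k)) (ℕ.+-identityʳ (fib (suc j)))
topFib-step false true  j _ = trans (cong (λ w → + fib (2 + j) ℤ.+ w)
                                         (trans (ℤ.+-identityˡ _) (ℤ.*-identityˡ (+ fib (3 + j)))))
                                  (ℤ.+-comm (+ fib (2 + j)) (+ fib (3 + j)))
topFib-step true  false j _ = cong +_ (ℕ.+-identityʳ (fib (3 + j)))
topFib-step true  true  j ()

1+t00+weight≡topFib : ∀ (c : ℕ → Bool) j → (∀ i → suc i < suc j → c i ∧ c (suc i) ≡ false) →
  + 1 ℤ.+ sumBelow (suc j) (t00 c) ℤ.+ sumBelow (suc j) (weight c) ≡ topFib (c j) j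
1+t00+weight≡topFib c zero    _ with c 0
... | false = refl
... | true  = refl
1+t00+weight≡topFib c (suc j) noOnes = begin
    + 1 ℤ.+ (T ℤ.+ t00 c (suc j)) ℤ.+ (W ℤ.+ weight c (suc j))
  ≡⟨ regroup (sumBelow (suc j) (t00 c)) (sumBelow (suc j) (weight c)) (t00 c (suc j)) (weight c (suc j)) ⟩
    (+ 1 ℤ.+ T ℤ.+ W) ℤ.+ (t00 c (suc j) ℤ.+ weight c (suc j))
  ≡⟨ cong₂ ℤ._+_ (1+t00+weight≡topFib c j (λ i i<j → noOnes i (ℕ.m≤n⇒m≤1+n i<j)))
                 (cong (λ k → t00 c (suc j) ℤ.+ bitℤ (c (suc j)) * + fib k) (ℕ.+-comm (suc j) 2)) ⟩
    topFib (c j) j ℤ.+ (t00 c (suc j) ℤ.+ bitℤ (c (suc j)) * + fib (3 + j))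
  ≡⟨ topFib-step (c j) (c (suc j)) j (noOnes j ℕ.≤-refl) ⟩
    topFib (c (suc j)) (suc j) ∎
  where
  open ≡-Reasoning
  T = sumBelow (suc j) (t00 c)
  W = sumBelow (suc j) (weight c)
  regroup : ∀ (t w t′ w′ : ℤ) →
    + 1 ℤ.+ (t ℤ.+ t′) ℤ.+ (w ℤ.+ w′) ≡ (+ 1 ℤ.+ t ℤ.+ w) ℤ.+ (t′ ℤ.+ w′)
  regroup = solve-∀

sumT00≡sum-t00 : ∀ {m} (b : Fin m → Bool) → sumT00 b ≡ sumBelow m (t00 (bit b))
sumT00≡sum-t00 {m} b = sumBelow-cong m λ { zero → refl ; (suc j) → refl }

bit-fromℕ : ∀ n (b : Fin (suc n) → Bool) → bit b n ≡ b (fromℕ n)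
bit-fromℕ n b with n <? suc n
... | yes _   = cong b (sym (fromℕ-def n))
... | no  n≮ = ⊥-elim (n≮ ℕ.≤-refl)

proposition14 : (n : ℕ) → (b : Fin (suc n) → Bool) → NoConsecutiveOnes b →
    (b (fromℕ n) ≡ false →
      + 1 Data.Integer.+ sumT00 b ≡ (+ fib (suc n + 1)) - sumBelow n (λ i → bitℤ (bit b i) * + fib (i + 2)))
    × (b (fromℕ n) ≡ true →
      + 1 Data.Integer.+ sumT00 b ≡ (+ fib (suc n + 2)) - sumBelow (suc n) (λ i → bitℤ (bit b i) * + fib (i + 2)))
proposition14 n b noOnes = whenFalse , whenTrue
  where
  open ≡-Reasoning
  W : ℕ → ℤ
  W m = sumBelow m (weight (bit b))
  invariant : + 1 ℤ.+ sumT00 b ℤ.+ W (suc n) ≡ topFib (bit b n) n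
  invariant = trans (cong (λ t → + 1 ℤ.+ t ℤ.+ W (suc n)) (sumT00≡sum-t00 b))
                    (1+t00+weight≡topFib (bit b) n noOnes)
  whenFalse : b (fromℕ n) ≡ false → + 1 ℤ.+ sumT00 b ≡ + fib (suc n + 1) - W n
  whenFalse top≡false = x+y≡z⇒x≡z-y (begin
      + 1 ℤ.+ sumT00 b ℤ.+ W n
    ≡⟨ cong (λ w → + 1 ℤ.+ sumT00 b ℤ.+ w)
            (sym (trans (cong (λ w → W n ℤ.+ w) (weight-false (bit b) n bitₙ≡false))
                        (ℤ.+-identityʳ (W n)))) ⟩
      + 1 ℤ.+ sumT00 b ℤ.+ W (suc n)
    ≡⟨ trans invariant (cong (λ v → topFib v n) bitₙ≡false) ⟩
      + fib (2 + n)
    ≡⟨ cong (λ k → + fib (suc k)) (ℕ.+-comm 1 n) ⟩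
      + fib (suc n + 1) ∎)
    where bitₙ≡false = trans (bit-fromℕ n b) top≡false
  whenTrue : b (fromℕ n) ≡ true → + 1 ℤ.+ sumT00 b ≡ + fib (suc n + 2) - W (suc n)
  whenTrue top≡true = x+y≡z⇒x≡z-y (begin
      + 1 ℤ.+ sumT00 b ℤ.+ W (suc n)
    ≡⟨ trans invariant (cong (λ v → topFib v n) (trans (bit-fromℕ n b) top≡true)) ⟩
      + fib (3 + n)
    ≡⟨ cong (λ k → + fib (suc k)) (ℕ.+-comm 2 n) ⟩
      + fib (suc n + 2) ∎)
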